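{- For every positive integer $k$, $\mathcal{L}(k) \geq \Omega\!\left(3, \lfloor k/2 \rfloor\right) - 1$.
   Context: A congruential $2$-power modulo $k$ is a word $x_1 x_2$ over the integers with $x_1, x_2$ nonempty, $|x_1| = |x_2|$, and $\sum x_1 \equiv \sum x_2 \pmod{k}$ ($\sum x$ = sum of entries). $\mathcal{L}(k)$ is the minimum integer $n$ such that for every coloring $\chi:[1,n] \to \{0,1,\ldots,k-1\}$, the word $\chi(1)\chi(2)\cdots\chi(n)$ contains a congruential $2$-power modulo $k$ as a factor. For integers $m \ge 3$ and $k \ge 0$, $\Omega(m,k)$ is the smallest integer $n$ such that every set $\{x_1, x_2, \ldots, x_n\}$ of integers with $x_i \in [(i-1)k+1, ik]$ for each $i$ contains an $m$-term arithmetic progression (with positive common difference). -}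

module Defs where

open import Data.Nat using (ℕ; zero; suc; _+_; _*_; _≤_; _<_; _<?_)
open import Data.Nat.DivMod using (_/_)
open import Data.Fin using (Fin; toℕ; fromℕ<)
open import Data.Integer using (ℤ; +_; _-_)
open import Data.Integer.Divisibility using (_∣_)
open import Data.Product using (Σ; ∃; _×_)
open import Relation.Binary.PropositionalEquality using (_≡_)
open import Relation.Nullary using (yes; no)

-- A coloring χ : [1,n] → {0,…,k-1}, positions shifted to 0-based: Fin n → Fin k.
Coloring : ℕ → ℕ → Set
Coloring n k = Fin n → Fin k

-- Entry at (0-based) position j of the word χ(1)…χ(n) (0 outside the word;
-- only used inside the word).
entry : ∀ {n k} → Coloring n k → ℕ → ℕ
entry {n} χ j with j <? n
... | yes j<n = toℕ (χ (fromℕ< j<n))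
... | no  _   = 0

segSum : ∀ {n k} → Coloring n k → ℕ → ℕ → ℕ
segSum χ i zero    = 0
segSum χ i (suc ℓ) = entry χ i + segSum χ (suc i) ℓ

HasCongSquare : ∀ {n} (k : ℕ) → Coloring n k → Set
HasCongSquare {n} k χ =
  Σ ℕ λ i → Σ ℕ λ ℓ → (1 ≤ ℓ) × (i + (ℓ + ℓ) ≤ n) ×
    ((+ k) ∣ ((+ segSum χ i ℓ) - (+ segSum χ (i + ℓ) ℓ)))

LProp : ℕ → ℕ → Set
LProp k n = (χ : Coloring n k) → HasCongSquare k χ

-- x : Fin n → ℕ lists x₁,…,xₙ (0-based index i stands for x_{i+1}),
-- with x_{i+1} ∈ [i·k+1, (i+1)·k].
Admissible : (n k : ℕ) → (Fin n → ℕ) → Set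
Admissible n k x = ∀ (i : Fin n) → (toℕ i * k + 1 ≤ x i) × (x i ≤ (suc (toℕ i)) * k)

HasAP : ∀ {n} (m : ℕ) → (Fin n → ℕ) → Set
HasAP {n} m x =
  Σ ℕ λ a → Σ ℕ λ d → (1 ≤ d) × (∀ j → j < m → ∃ λ (i : Fin n) → x i ≡ a + j * d)

ΩProp : ℕ → ℕ → ℕ → Set
ΩProp m k n = (x : Fin n → ℕ) → Admissible n k x → HasAP m x

IsLeast : (ℕ → Set) → ℕ → Set
IsLeast P n = P n × (∀ n' → P n' → n ≤ n')

-- Let h = ⌊k/2⌋ and x₀ < … < x_L with x_j ∈ [jh+1, (j+1)h].  The gaps x_{j+1} − x_j
-- are below 2h ≤ k, so they form a word over {0,…,k−1}.  A factor of length l of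
-- this word sums to x_{i+l} − x_i, which lies strictly between lh − h and lh + h.
-- The two halves of a congruential square therefore have sums that are congruent
-- mod k but less than 2h ≤ k apart, hence equal, and x_i, x_{i+l}, x_{i+2l} is a
-- 3-term progression.  So 𝓛(k) + 1 has the property defining Ω(3, ⌊k/2⌋).
module Submission where

open import Defs
open import Data.Nat using (ℕ; zero; suc; _+_; _*_; _∸_; _≤_; _<_; s≤s; z<s)
open import Data.Nat.DivMod using (_/_; m/n*n≤m)
open import Data.Nat.Properties
open import Data.Nat.Divisibility using (>⇒∤) renaming (_∣_ to _∣ℕ_)
open import Data.Nat.Tactic.RingSolver using (solve)
open import Data.Fin.Base using (Fin; toℕ; fromℕ<)
open import Data.Fin.Properties using (toℕ-fromℕ<; toℕ<n)
open import Data.Integer.Base using (+_; _⊖_) renaming (_-_ to _-ℤ_; ∣_∣ to ∣_∣ℤ)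
open import Data.Integer.Properties using ([+m]-[+n]≡m⊖n; ∣⊖∣-≤; ∣m⊖n∣≡∣n⊖m∣)
open import Data.Integer.Divisibility using (_∣_)
open import Data.List.Base using (_∷_; [])
open import Data.Product.Base using (∃; _×_; _,_; proj₁; proj₂)
open import Data.Sum.Base using (inj₁; inj₂)
open import Relation.Nullary using (yes; no; contradiction)
open import Relation.Binary.PropositionalEquality

∣∧<⇒≡0 : ∀ {k m} → k ∣ℕ m → m < k → m ≡ 0
∣∧<⇒≡0 {m = zero}  _   _   = refl
∣∧<⇒≡0 {m = suc _} k∣m m<k = contradiction k∣m (>⇒∤ m<k)

∣∸∧<⇒≡ : ∀ {k m n} → k ∣ℕ (n ∸ m) → m ≤ n → n < m + k → m ≡ n
∣∸∧<⇒≡ {k} {m} {n} k∣n∸m m≤n n<m+k = ≤-antisym m≤n (m∸n≡0⇒m≤n (∣∧<⇒≡0 k∣n∸m n∸m<k))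
  where
  n∸m<k : n ∸ m < k
  n∸m<k = subst (n ∸ m <_) (m+n∸m≡n m k) (∸-monoˡ-< n<m+k m≤n)

congruent∧close⇒≡ : ∀ {k m n} → (+ k) ∣ ((+ m) -ℤ (+ n)) → m < n + k → n < m + k → m ≡ n
congruent∧close⇒≡ {k} {m} {n} k∣m-n m<n+k n<m+k with ≤-total m n
... | inj₁ m≤n = ∣∸∧<⇒≡ (subst (k ∣ℕ_) (∣⊖∣-≤ m≤n) k∣∣m⊖n∣) m≤n n<m+k
  where
  k∣∣m⊖n∣ : k ∣ℕ ∣ m ⊖ n ∣ℤ
  k∣∣m⊖n∣ = subst (λ i → k ∣ℕ ∣ i ∣ℤ) ([+m]-[+n]≡m⊖n m n) k∣m-n
... | inj₂ n≤m = sym (∣∸∧<⇒≡ (subst (k ∣ℕ_) (∣⊖∣-≤ n≤m) k∣∣n⊖m∣) n≤m m<n+k)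
  where
  k∣∣n⊖m∣ : k ∣ℕ ∣ n ⊖ m ∣ℤ
  k∣∣n⊖m∣ = subst (k ∣ℕ_) (trans (cong ∣_∣ℤ ([+m]-[+n]≡m⊖n m n)) (∣m⊖n∣≡∣n⊖m∣ m n)) k∣m-n

InBlock : ℕ → ℕ → ℕ → Set
InBlock h j x = j * h + 1 ≤ x × x ≤ suc j * h

InWindow : ℕ → ℕ → ℕ → Set
InWindow h l d = d < l * h + h × l * h < d + h

step-inWindow : ∀ {h i l x y d} → InBlock h i x → InBlock h (i + l) y → x + d ≡ y → InWindow h l d
step-inWindow {h} {i} {l} {x} {y} {d} (x-lo , x-hi) (y-lo , y-hi) x+d≡y =
  +-cancelˡ-≤ (i * h) (suc d) (l * h + h) upper , +-cancelˡ-≤ (i * h) (suc (l * h)) (d + h) lower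
  where
  open ≤-Reasoning
  upper : i * h + suc d ≤ i * h + (l * h + h)
  upper = begin
    i * h + suc d       ≡⟨ solve (i ∷ h ∷ d ∷ []) ⟩
    (i * h + 1) + d     ≤⟨ +-monoˡ-≤ d x-lo ⟩
    x + d               ≡⟨ x+d≡y ⟩
    y                   ≤⟨ y-hi ⟩
    suc (i + l) * h     ≡⟨ solve (i ∷ l ∷ h ∷ []) ⟩
    i * h + (l * h + h) ∎
  lower : i * h + suc (l * h) ≤ i * h + (d + h)
  lower = begin
    i * h + suc (l * h) ≡⟨ solve (i ∷ l ∷ h ∷ []) ⟩
    (i + l) * h + 1     ≤⟨ y-lo ⟩
    y                   ≡⟨ x+d≡y ⟨
    x + d               ≤⟨ +-monoˡ-≤ d x-hi ⟩
    suc i * h + d       ≡⟨ solve (i ∷ h ∷ d ∷ []) ⟩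
    i * h + (d + h)     ∎

congruent-steps⇒≡ : ∀ {k h i l x y z d e} → h + h ≤ k →
                    InBlock h i x → InBlock h (i + l) y → InBlock h (i + l + l) z →
                    x + d ≡ y → y + e ≡ z → (+ k) ∣ ((+ d) -ℤ (+ e)) → d ≡ e
congruent-steps⇒≡ {k} {h} {i} {l} {d = d} {e} 2h≤k x∈ y∈ z∈ x+d≡y y+e≡z k∣d-e =
  congruent∧close⇒≡ k∣d-e (close d-window e-window) (close e-window d-window)
  where
  d-window : InWindow h l d
  d-window = step-inWindow {i = i} x∈ y∈ x+d≡y
  e-window : InWindow h l e
  e-window = step-inWindow {i = i + l} y∈ z∈ y+e≡z
  close : ∀ {a b} → InWindow h l a → InWindow h l b → a < b + k
  close {a} {b} (a<lh+h , _) (_ , lh<b+h) = begin-strict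
    a           <⟨ a<lh+h ⟩
    l * h + h   ≤⟨ +-monoˡ-≤ h (<⇒≤ lh<b+h) ⟩
    b + h + h   ≡⟨ +-assoc b h h ⟩
    b + (h + h) ≤⟨ +-monoʳ-≤ b 2h≤k ⟩
    b + k       ∎
    where open ≤-Reasoning

segSum-telescope : ∀ {n k} (χ : Coloring n k) (X : ℕ → ℕ) →
                   (∀ {j} → j < n → X j + entry χ j ≡ X (suc j)) →
                   ∀ i l → i + l ≤ n → X i + segSum χ i l ≡ X (i + l)
segSum-telescope χ X step i zero    _       = trans (+-identityʳ (X i)) (cong X (sym (+-identityʳ i)))
segSum-telescope {n} χ X step i (suc l) i+l+1≤n = begin
  X i + (entry χ i + segSum χ (suc i) l) ≡⟨ +-assoc (X i) _ _ ⟨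
  X i + entry χ i + segSum χ (suc i) l   ≡⟨ cong (_+ segSum χ (suc i) l) (step i<n) ⟩
  X (suc i) + segSum χ (suc i) l         ≡⟨ segSum-telescope χ X step (suc i) l 1+i+l≤n ⟩
  X (suc i + l)                          ≡⟨ cong X (+-suc i l) ⟨
  X (i + suc l)                          ∎
  where
  open ≡-Reasoning
  i<n : i < n
  i<n = <-≤-trans (m<m+n i z<s) i+l+1≤n
  1+i+l≤n : suc i + l ≤ n
  1+i+l≤n = subst (_≤ n) (+-suc i l) i+l+1≤n

extend : ∀ {n} → (Fin n → ℕ) → ℕ → ℕ
extend {n} x j with j <? n
... | yes j<n = x (fromℕ< j<n)
... | no  _   = 0

extend-fromℕ< : ∀ {n} (x : Fin n → ℕ) {j} (j<n : j < n) → extend x j ≡ x (fromℕ< j<n)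
extend-fromℕ< {n} x {j} j<n with j <? n
... | yes j<n′ = cong (λ p → x (fromℕ< p)) (<-irrelevant j<n′ j<n)
... | no  j≮n  = contradiction j<n j≮n

entry-fromℕ< : ∀ {n k} (χ : Coloring n k) {j} (j<n : j < n) → entry χ j ≡ toℕ (χ (fromℕ< j<n))
entry-fromℕ< {n} χ {j} j<n with j <? n
... | yes j<n′ = cong (λ p → toℕ (χ (fromℕ< p))) (<-irrelevant j<n′ j<n)
... | no  j≮n  = contradiction j<n j≮n

equalSteps⇒HasAP3 : ∀ {n} (x : Fin n → ℕ) {a d} (f₀ f₁ f₂ : Fin n) → 1 ≤ d →
                    x f₀ ≡ a → x f₁ ≡ a + d → x f₂ ≡ a + d + d → HasAP 3 x
equalSteps⇒HasAP3 x {a} {d} f₀ f₁ f₂ 1≤d x₀ x₁ x₂ = a , d , 1≤d , term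
  where
  term : ∀ j → j < 3 → ∃ λ f → x f ≡ a + j * d
  term 0 _ = f₀ , trans x₀ (solve (a ∷ []))
  term 1 _ = f₁ , trans x₁ (solve (a ∷ d ∷ []))
  term 2 _ = f₂ , trans x₂ (solve (a ∷ d ∷ []))
  term (suc (suc (suc _))) (s≤s (s≤s (s≤s ())))

module GapWord {k h L : ℕ} (2h≤k : h + h ≤ k)
               (x : Fin (suc L) → ℕ) (x-admissible : Admissible (suc L) h x) where

  X : ℕ → ℕ
  X = extend x

  at : ∀ {j} → j ≤ L → Fin (suc L)
  at j≤L = fromℕ< (s≤s j≤L)

  x-at : ∀ {j} (j≤L : j ≤ L) → x (at j≤L) ≡ X j
  x-at j≤L = sym (extend-fromℕ< x (s≤s j≤L))

  X-inBlock : ∀ {j} → j ≤ L → InBlock h j (X j)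
  X-inBlock j≤L = subst₂ (InBlock h) (toℕ-fromℕ< (s≤s j≤L)) (x-at j≤L) (x-admissible (at j≤L))

  gap : ℕ → ℕ
  gap j = X (suc j) ∸ X j

  X+gap : ∀ {j} → j < L → X j + gap j ≡ X (suc j)
  X+gap j<L = m+[n∸m]≡n (≤-trans (proj₂ (X-inBlock (<⇒≤ j<L)))
                                 (≤-trans (m≤m+n _ 1) (proj₁ (X-inBlock j<L))))

  gap<k : ∀ {j} → j < L → gap j < k
  gap<k {j} j<L = <-≤-trans (subst (λ c → gap j < c + h) (*-identityˡ h) (proj₁ window)) 2h≤k
    where
    window : InWindow h 1 (gap j)
    window = step-inWindow {i = j} (X-inBlock (<⇒≤ j<L))
               (subst (λ i → InBlock h i (X (suc j))) (+-comm 1 j) (X-inBlock j<L)) (X+gap j<L)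

  gapWord : Coloring L k
  gapWord f = fromℕ< (gap<k (toℕ<n f))

  X+entry : ∀ {j} → j < L → X j + entry gapWord j ≡ X (suc j)
  X+entry {j} j<L = begin
    X j + entry gapWord j                  ≡⟨ cong (λ v → X j + v) (entry-fromℕ< gapWord j<L) ⟩
    X j + toℕ (gapWord (fromℕ< j<L))       ≡⟨ cong (λ v → X j + v) (toℕ-fromℕ< _) ⟩
    X j + gap (toℕ (fromℕ< j<L))           ≡⟨ cong (λ i → X j + gap i) (toℕ-fromℕ< j<L) ⟩
    X j + gap j                            ≡⟨ X+gap j<L ⟩
    X (suc j)                              ∎
    where open ≡-Reasoning

  congSquare⇒HasAP3 : HasCongSquare k gapWord → HasAP 3 x
  congSquare⇒HasAP3 (i , l , 1≤l , i+2l≤L , k∣A-B) =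
    equalSteps⇒HasAP3 x (at i≤L) (at i+l≤L) (at i+l+l≤L) 0<A
      (x-at i≤L)
      (trans (x-at i+l≤L) (sym X+A))
      (trans (x-at i+l+l≤L) (trans (sym X+B) (cong₂ _+_ (sym X+A) (sym A≡B))))
    where
    A = segSum gapWord i l
    B = segSum gapWord (i + l) l
    i+l+l≤L : i + l + l ≤ L
    i+l+l≤L = subst (_≤ L) (sym (+-assoc i l l)) i+2l≤L
    i+l≤L : i + l ≤ L
    i+l≤L = ≤-trans (m≤m+n (i + l) l) i+l+l≤L
    i≤L : i ≤ L
    i≤L = ≤-trans (m≤m+n i l) i+l≤L
    X+A : X i + A ≡ X (i + l)
    X+A = segSum-telescope gapWord X X+entry i l i+l≤L
    X+B : X (i + l) + B ≡ X (i + l + l)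
    X+B = segSum-telescope gapWord X X+entry (i + l) l i+l+l≤L
    A≡B : A ≡ B
    A≡B = congruent-steps⇒≡ {h = h} {i} {l} 2h≤k
            (X-inBlock i≤L) (X-inBlock i+l≤L) (X-inBlock i+l+l≤L) X+A X+B k∣A-B
    0<A : 0 < A
    0<A = +-cancelʳ-< h 0 A (≤-<-trans h≤lh (proj₂ A-window))
      where
      A-window : InWindow h l A
      A-window = step-inWindow {i = i} (X-inBlock i≤L) (X-inBlock i+l≤L) X+A
      h≤lh : h ≤ l * h
      h≤lh = subst (_≤ l * h) (*-identityˡ h) (*-monoˡ-≤ h 1≤l)

LProp⇒ΩProp : ∀ {k h L} → h + h ≤ k → LProp k L → ΩProp 3 h (suc L)
LProp⇒ΩProp 2h≤k L-works x x-admissible =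
  congSquare⇒HasAP3 (L-works gapWord)
  where open GapWord 2h≤k x x-admissible

half+half≤ : ∀ k → k / 2 + k / 2 ≤ k
half+half≤ k = subst (_≤ k) [k/2]*2≡ (m/n*n≤m k 2)
  where
  [k/2]*2≡ : k / 2 * 2 ≡ k / 2 + k / 2
  [k/2]*2≡ = trans (*-suc (k / 2) 1) (cong (λ v → k / 2 + v) (*-identityʳ (k / 2)))

lemma9 : ∀ (k : ℕ) → 1 ≤ k → ∀ (L Ω : ℕ) →
           IsLeast (LProp k) L → IsLeast (ΩProp 3 (k / 2)) Ω →
           Ω ∸ 1 ≤ L
lemma9 k _ L Ω (L-works , _) (_ , Ω-least) =
  ∸-monoˡ-≤ 1 (Ω-least (suc L) (LProp⇒ΩProp (half+half≤ k) L-works))
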